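{- Let $\mathcal{F}$ be a class of graphs and let $n$ be a nonnegative integer. Then $\operatorname{ad}(\mathcal{F}^{+n})=\operatorname{ad}(\mathcal{F})$.
   Context: All graphs are finite. For a class $\mathcal{F}$ of graphs and a nonnegative integer $n$, $\mathcal{F}^{+n}$ is the class of graphs $G$ for which there exists $Z\subseteq V(G)$ with $|Z|\le n$ such that $G-Z\in\mathcal{F}$. For a graph $G$ and $x,y\in V(G)$, $d_G(x,y)$ is the minimum number of edges of a path in $G$ between $x$ and $y$. For a nonnegative integer $n$, an $n$-dimensional control function for a class $\mathcal{F}$ of graphs is a function $f:\mathbb{R}^+\to\mathbb{R}^+$ such that for every $G\in\mathcal{F}$ and every real $r>0$ there exist collections $\mathcal{U}_1,\dots,\mathcal{U}_{n+1}$ of subsets of $V(G)$ covering $V(G)$, such that for each $i$, whenever $U\neq U'$ are in $\mathcal{U}_i$ and $x\in U$, $x'\in U'$, we have $d_G(x,x')>r$, and whenever $x,x'$ lie in a common $U\in\mathcal{U}_i$ we have $d_G(x,x')\le f(r)$. The asymptotic dimension $\operatorname{ad}(\mathcal{F})$ is the minimum $n$ for which there is a common $n$-dimensional control function for all graphs in $\mathcal{F}$. -}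

module Defs where

open import Data.Nat using (ℕ; zero; suc; _≤_; _<_)
open import Data.Bool using (Bool; true; false)
open import Data.Fin using (Fin)
import Data.Fin as F
open import Data.Fin.Subset using (Subset; _∈_; _∉_; ∣_∣)
open import Data.List using (List)
import Data.List.Membership.Propositional as LM
open import Data.Product using (Σ; ∃; ∃-syntax; _×_; _,_)
open import Relation.Binary.PropositionalEquality using (_≡_; _≢_)
open import Relation.Nullary using (¬_)
open import Function.Bundles using (_⇔_)

-- A finite simple graph on the vertex set Fin order.
-- Symmetry / irreflexivity are irrelevant fields, so graphs with the
-- same order and adjacency are definitionally equal.
record Graph : Set where
  field
    order : ℕ
    adj   : Fin order → Fin order → Bool
    .sym    : ∀ x y → adj x y ≡ adj y x
    .irrefl : ∀ x → adj x x ≡ false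
open Graph public

Class : Set₁
Class = Graph → Set

-- Reach G m x y : there is a walk of at most m edges from x to y,
-- i.e. d_G(x,y) ≤ m  (d_G(x,y) = ∞ when no path exists).
data Reach (G : Graph) : ℕ → Fin (order G) → Fin (order G) → Set where
  here : ∀ {m x} → Reach G m x x
  step : ∀ {m x y z} → adj G x y ≡ true → Reach G m y z → Reach G (suc m) x z

-- Deletion G Z H : H is G - Z, with the vertices of V(G) ∖ Z relabelled
-- by Fin (order H) in increasing order (e is the order-preserving
-- bijection from V(H) onto V(G) ∖ Z, and H is the induced subgraph).
record Deletion (G : Graph) (Z : Subset (order G)) (H : Graph) : Set where
  field
    emb      : Fin (order H) → Fin (order G)
    increasing : ∀ i j → i F.< j → emb i F.< emb j
    onto     : ∀ v → v ∉ Z → ∃[ i ] emb i ≡ v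
    avoids   : ∀ i → emb i ∉ Z
    induced  : ∀ i j → adj H i j ≡ adj G (emb i) (emb j)

Plus : Class → ℕ → Class
Plus 𝓕 k G = Σ (Subset (order G)) λ Z → ∣ Z ∣ ≤ k × Σ Graph λ H → Deletion G Z H × 𝓕 H

Covers : (G : Graph) (d : ℕ) → (Fin (suc d) → List (Subset (order G))) → Set
Covers G d 𝓤 = ∀ x → ∃[ i ] ∃[ U ] (U LM.∈ 𝓤 i × x ∈ U)

Separated : (G : Graph) (d : ℕ) → (Fin (suc d) → List (Subset (order G))) → ℕ → Set
Separated G d 𝓤 r = ∀ i U U' → U LM.∈ 𝓤 i → U' LM.∈ 𝓤 i → U ≢ U' →
  ∀ x x' → x ∈ U → x' ∈ U' → ¬ Reach G r x x'

Bounded : (G : Graph) (d : ℕ) → (Fin (suc d) → List (Subset (order G))) → ℕ → Set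
Bounded G d 𝓤 b = ∀ i U → U LM.∈ 𝓤 i → ∀ x x' → x ∈ U → x' ∈ U → Reach G b x x'

-- d-dimensional control function (radii discretised to ℕ).
IsControlFunction : Class → ℕ → (ℕ → ℕ) → Set
IsControlFunction 𝓕 d f = ∀ G → 𝓕 G → ∀ (r : ℕ) →
  Σ (Fin (suc d) → List (Subset (order G))) λ 𝓤 →
    Covers G d 𝓤 × Separated G d 𝓤 r × Bounded G d 𝓤 (f r)

HasDim : Class → ℕ → Set
HasDim 𝓕 d = ∃[ f ] IsControlFunction 𝓕 d f

AdIs : Class → ℕ → Set
AdIs 𝓕 d = HasDim 𝓕 d × (∀ e → e < d → ¬ HasDim 𝓕 e)

AdInfinite : Class → Set
AdInfinite 𝓕 = ∀ d → ¬ HasDim 𝓕 d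

module Submission where

-- Since 𝓕 ⊆ 𝓕^{+n} (take Z = ∅), a control function for 𝓕^{+n} is one for
-- 𝓕.  The content is the converse: if f is a d-dimensional control function
-- for 𝓕, then growⁿ n f, the n-fold iterate of  grow f r = 2 (2r + f r),  is
-- one for 𝓕^{+n}.
--
-- Inside a fixed graph G we fix a list D of removed vertices and measure
-- G − D by walks whose vertices, except possibly the last, avoid D.  A family
-- controlling G − D in this sense is said to control G outside D.  The key
-- lemma (module Restore) puts one removed vertex z back: a family controlling
-- G outside z ∷ D with bound f yields one controlling G outside D with bound
-- grow f, by merging the r-ball around z with every member of the 0-th
-- collection that comes within 2r of z, and deleting the merged set (or just
-- the r-ball) from the other members.  Iterating this over the elements of Z,
-- starting from the family obtained from G − Z ∈ 𝓕 through the relabelling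
-- recorded in Deletion, controls G itself.

open import Defs
open import Data.Nat using (ℕ)
open import Data.Product using (_×_)
open import Function.Bundles using (_⇔_)

open import Data.Nat using (zero; suc; _+_; _≤_; _≤′_; ≤′-refl; ≤′-step; z≤n; s≤s)
open import Data.Nat.Properties
  using (≤-refl; ≤-reflexive; ≤-trans; m≤m+n; m≤n+m; n≤1+n; +-mono-≤; +-monoʳ-≤; ≤⇒≤′)
open import Data.Bool using (true; false)
import Data.Bool as Bool
open import Data.Fin using (Fin)
import Data.Fin as F
import Data.Fin.Properties as FP
open import Data.Fin.Subset using (Subset; _∈_; ∣_∣; ⊥)
open import Data.Fin.Subset.Properties using (_∈?_; ∉⊥; ∣⊥∣≡0)
import Data.Vec as Vec
open import Data.Vec.Properties using (lookup∘tabulate; lookup⇒[]=; []=⇒lookup)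
open import Data.List using (List; []; _∷_; map; length)
open import Data.List.Properties using (length-map)
open import Data.List.Relation.Unary.Any using (Any; here; there)
import Data.List.Relation.Unary.Any as Any
open import Data.List.Membership.Propositional using (find; lose)
  renaming (_∈_ to _∈ₗ_; _∉_ to _∉ₗ_)
open import Data.List.Membership.Propositional.Properties using (∈-map⁺; ∈-map⁻)
open import Data.Product using (Σ; ∃-syntax; _,_)
open import Data.Sum using (_⊎_; inj₁; inj₂)
open import Data.Empty using (⊥-elim)
open import Relation.Nullary using (¬_; Dec; yes; no; does)
open import Relation.Nullary.Decidable using (_×-dec_; _⊎-dec_; ¬?; recompute; dec-true)
open import Relation.Binary.PropositionalEquality using (_≡_; _≢_; refl; trans; cong; subst)
  renaming (sym to ≡-sym)
open import Relation.Binary.Definitions using (tri<; tri≈; tri>)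
open import Function.Bundles using (mk⇔)

does⇒proof : ∀ {A : Set} (a? : Dec A) → does a? ≡ true → A
does⇒proof (yes a) _ = a
does⇒proof (no _) ()

subset : ∀ {k} {P : Fin k → Set} → (∀ x → Dec (P x)) → Subset k
subset P? = Vec.tabulate (λ x → does (P? x))

∈subset⁺ : ∀ {k} {P : Fin k → Set} (P? : ∀ x → Dec (P x)) {x} → P x → x ∈ subset P?
∈subset⁺ P? {x} px = lookup⇒[]= x _ (trans (lookup∘tabulate _ x) (dec-true (P? x) px))

∈subset⁻ : ∀ {k} {P : Fin k → Set} (P? : ∀ x → Dec (P x)) {x} → x ∈ subset P? → P x
∈subset⁻ P? {x} x∈ = does⇒proof (P? x) (trans (≡-sym (lookup∘tabulate _ x)) ([]=⇒lookup x∈))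

elements : ∀ {k} → Subset k → List (Fin k)
elements Vec.[] = []
elements (true Vec.∷ p) = F.zero ∷ map F.suc (elements p)
elements (false Vec.∷ p) = map F.suc (elements p)

length-elements : ∀ {k} (p : Subset k) → length (elements p) ≡ ∣ p ∣
length-elements Vec.[] = refl
length-elements (true Vec.∷ p) = cong suc (trans (length-map F.suc (elements p)) (length-elements p))
length-elements (false Vec.∷ p) = trans (length-map F.suc (elements p)) (length-elements p)

∈elements⁺ : ∀ {k} {p : Subset k} {x} → x ∈ p → x ∈ₗ elements p
∈elements⁺ {p = true Vec.∷ p} Vec.here = here refl
∈elements⁺ {p = true Vec.∷ p} (Vec.there x∈) = there (∈-map⁺ F.suc (∈elements⁺ x∈))
∈elements⁺ {p = false Vec.∷ p} (Vec.there x∈) = ∈-map⁺ F.suc (∈elements⁺ x∈)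

∈elements⁻ : ∀ {k} {p : Subset k} {x} → x ∈ₗ elements p → x ∈ p
∈elements⁻ {p = true Vec.∷ p} (here refl) = Vec.here
∈elements⁻ {p = true Vec.∷ p} (there x∈) with ∈-map⁻ F.suc x∈
... | y , y∈ , refl = Vec.there (∈elements⁻ y∈)
∈elements⁻ {p = false Vec.∷ p} x∈ with ∈-map⁻ F.suc x∈
... | y , y∈ , refl = Vec.there (∈elements⁻ y∈)

-- The bound after putting back one vertex: the merged set lies within
-- r + r + f r of the restored vertex, so its diameter is at most twice that.

grow : (ℕ → ℕ) → ℕ → ℕ
grow f r = (r + r + f r) + (r + r + f r)

growⁿ : ℕ → (ℕ → ℕ) → ℕ → ℕ
growⁿ zero f = f
growⁿ (suc k) f = growⁿ k (grow f)

f≤grow : ∀ f r → f r ≤ grow f r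
f≤grow f r = ≤-trans (m≤n+m (f r) (r + r)) (m≤m+n _ _)

grow-mono : ∀ {f g} → (∀ r → f r ≤ g r) → ∀ r → grow f r ≤ grow g r
grow-mono f≤g r = +-mono-≤ (+-monoʳ-≤ (r + r) (f≤g r)) (+-monoʳ-≤ (r + r) (f≤g r))

growⁿ-mono : ∀ k {f g} → (∀ r → f r ≤ g r) → ∀ r → growⁿ k f r ≤ growⁿ k g r
growⁿ-mono zero f≤g = f≤g
growⁿ-mono (suc k) f≤g = growⁿ-mono k (grow-mono f≤g)

-- Removing fewer vertices needs fewer growth steps: growⁿ is increasing in
-- the number of iterations, so one bound serves every |Z| ≤ n.
growⁿ-monoⁿ : ∀ {k n} → k ≤′ n → ∀ f r → growⁿ k f r ≤ growⁿ n f r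
growⁿ-monoⁿ ≤′-refl f r = ≤-refl
growⁿ-monoⁿ (≤′-step {n} k≤n) f r =
  ≤-trans (growⁿ-monoⁿ k≤n f r) (growⁿ-mono n (f≤grow f) r)

Controls : Graph → ℕ → (ℕ → ℕ) → Set
Controls G d f = ∀ r → Σ (Fin (suc d) → List (Subset (order G))) λ 𝓤 →
  Covers G d 𝓤 × Separated G d 𝓤 r × Bounded G d 𝓤 (f r)

-- Adjacency is symmetric (the field is irrelevant, so it is recomputed).
adj-sym : (G : Graph) → ∀ x y → adj G x y ≡ true → adj G y x ≡ true
adj-sym record { adj = a ; sym = a-sym } x y e = trans (recompute (a y x Bool.≟ a x y) (a-sym y x)) e

module Avoiding (G : Graph) where

  V : Set
  V = Fin (order G)

  -- Walk D m x y: a walk of at most m edges from x to y all of whose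
  -- vertices except the last lie outside D; for x, y ∉ D this is
  -- d_{G−D}(x,y) ≤ m.
  data Walk (D : List V) : ℕ → V → V → Set where
    here : ∀ {m x} → Walk D m x x
    step : ∀ {m x y z} → x ∉ₗ D → adj G x y ≡ true → Walk D m y z → Walk D (suc m) x z

  walk-mono : ∀ {D m m' x y} → m ≤ m' → Walk D m x y → Walk D m' x y
  walk-mono _ here = here
  walk-mono (s≤s m≤m') (step x∉ e w) = step x∉ e (walk-mono m≤m' w)

  _++ʷ_ : ∀ {D a b x y z} → Walk D a x y → Walk D b y z → Walk D (a + b) x z
  _++ʷ_ {a = a} {b} here w = walk-mono (m≤n+m b a) w
  step x∉ e w ++ʷ w' = step x∉ e (w ++ʷ w')

  start∉ : ∀ {D m x y} → Walk D m x y → y ∉ₗ D → x ∉ₗ D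
  start∉ here y∉ = y∉
  start∉ (step x∉ _ _) _ = x∉

  snoc : ∀ {D m x y z} → Walk D m x y → y ∉ₗ D → adj G y z ≡ true → Walk D (suc m) x z
  snoc here y∉ e = step y∉ e here
  snoc (step x∉ e w) y∉ e' = step x∉ e (snoc w y∉ e')

  -- Reversal needs the end point outside D, as it becomes the start.
  reverse : ∀ {D m x y} → Walk D m x y → y ∉ₗ D → Walk D m y x
  reverse here _ = here
  reverse (step {x = x} {y} x∉ e w) z∉ = snoc (reverse w z∉) (start∉ w z∉) (adj-sym G x y e)

  unavoid : ∀ {z D m x y} → Walk (z ∷ D) m x y → Walk D m x y
  unavoid here = here
  unavoid (step x∉ e w) = step (λ x∈ → x∉ (there x∈)) e (unavoid w)

  ∉-∷ : ∀ {x z : V} {D} → x ∉ₗ D → x ≢ z → x ∉ₗ z ∷ D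
  ∉-∷ _ x≢z (here x≡z) = x≢z x≡z
  ∉-∷ x∉ _ (there x∈) = x∉ x∈

  avoid-or-from : ∀ {D m x y} (z : V) → Walk D m x y → Walk (z ∷ D) m x y ⊎ Walk D m z y
  avoid-or-from z here = inj₁ here
  avoid-or-from {x = x} z (step x∉ e w) with x FP.≟ z | avoid-or-from z w
  ... | yes refl | _ = inj₂ (step x∉ e w)
  ... | no x≢z | inj₁ w' = inj₁ (step (∉-∷ x∉ x≢z) e w')
  ... | no _ | inj₂ w' = inj₂ (walk-mono (n≤1+n _) w')

  walk? : ∀ D m x y → Dec (Walk D m x y)
  walk? D m x y with x FP.≟ y
  ... | yes refl = yes here
  walk? D zero x y | no x≢y = no λ { here → x≢y refl }
  walk? D (suc m) x y | no x≢y with Any.any? (FP._≟_ x) D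
  ... | yes x∈ = no λ { here → x≢y refl ; (step x∉ _ _) → x∉ x∈ }
  ... | no x∉ with FP.any? (λ y' → (adj G x y' Bool.≟ true) ×-dec walk? D m y' y)
  ...   | yes (y' , e , w) = yes (step x∉ e w)
  ...   | no ¬w = no λ { here → x≢y refl ; (step _ e w) → ¬w (_ , e , w) }

  Family : ℕ → Set
  Family d = Fin (suc d) → List (Subset (order G))

  CoversOutside : List V → (d : ℕ) → Family d → Set
  CoversOutside D d 𝓤 = ∀ x → x ∉ₗ D → ∃[ i ] ∃[ U ] (U ∈ₗ 𝓤 i × x ∈ U)

  SeparatedOutside : List V → (d : ℕ) → Family d → ℕ → Set
  SeparatedOutside D d 𝓤 r = ∀ i U U' → U ∈ₗ 𝓤 i → U' ∈ₗ 𝓤 i → U ≢ U' →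
    ∀ x x' → x ∈ U → x' ∈ U' → x ∉ₗ D → x' ∉ₗ D → ¬ Walk D r x x'

  BoundedOutside : List V → (d : ℕ) → Family d → ℕ → Set
  BoundedOutside D d 𝓤 b = ∀ i U → U ∈ₗ 𝓤 i → ∀ x x' → x ∈ U → x' ∈ U →
    x ∉ₗ D → x' ∉ₗ D → Walk D b x x'

  ControlledOutside : List V → (d : ℕ) → (ℕ → ℕ) → Set
  ControlledOutside D d f = ∀ r → Σ (Family d) λ 𝓤 →
    CoversOutside D d 𝓤 × SeparatedOutside D d 𝓤 r × BoundedOutside D d 𝓤 (f r)

  controlled-mono : ∀ {D d f g} → (∀ r → f r ≤ g r) → ControlledOutside D d f → ControlledOutside D d g
  controlled-mono f≤g ctrl r with ctrl r
  ... | 𝓤 , cov , sep , bnd = 𝓤 , cov , sep ,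
        λ i U U∈ x x' x∈ x'∈ x∉ x'∉ → walk-mono (f≤g r) (bnd i U U∈ x x' x∈ x'∈ x∉ x'∉)

  walk→reach : ∀ {m x y} → Walk [] m x y → Reach G m x y
  walk→reach here = here
  walk→reach (step _ e w) = step e (walk→reach w)

  reach→walk : ∀ {m x y} → Reach G m x y → Walk [] m x y
  reach→walk here = here
  reach→walk (step e w) = step (λ ()) e (reach→walk w)

  controlled-[] : ∀ {d f} → ControlledOutside [] d f → Controls G d f
  controlled-[] ctrl r with ctrl r
  ... | 𝓤 , cov , sep , bnd = 𝓤 , (λ x → cov x (λ ())) ,
        (λ i U U' U∈ U'∈ U≢U' x x' x∈ x'∈ p →
           sep i U U' U∈ U'∈ U≢U' x x' x∈ x'∈ (λ ()) (λ ()) (reach→walk p)) ,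
        (λ i U U∈ x x' x∈ x'∈ → walk→reach (bnd i U U∈ x x' x∈ x'∈ (λ ()) (λ ())))

  module Restore (z : V) (D : List V) {d : ℕ} {f : ℕ → ℕ} {r : ℕ} (𝓤 : Family d)
                 (cov : CoversOutside (z ∷ D) d 𝓤) (sep : SeparatedOutside (z ∷ D) d 𝓤 r)
                 (bnd : BoundedOutside (z ∷ D) d 𝓤 (f r)) where

    Ball : V → Set
    Ball x = Walk D r z x

    Near : Subset (order G) → Set
    Near U = ∃[ u ] (u ∈ U × u ∉ₗ z ∷ D × Walk D (r + r) z u)

    Merged : V → Set
    Merged x = Ball x ⊎ Any (λ U → Near U × x ∈ U) (𝓤 F.zero)

    ball? : ∀ x → Dec (Ball x)
    ball? = walk? D r z

    near? : ∀ U → Dec (Near U)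
    near? U = FP.any? (λ u → (u ∈? U) ×-dec ¬? (Any.any? (FP._≟_ u) (z ∷ D)) ×-dec walk? D (r + r) z u)

    merged? : ∀ x → Dec (Merged x)
    merged? x = ball? x ⊎-dec Any.any? (λ U → near? U ×-dec (x ∈? U)) (𝓤 F.zero)

    C : Subset (order G)
    C = subset merged?

    -- What is cut out of the members of the i-th collection: the merged set
    -- from those of 𝓤 0 (they may meet it), only the ball from the others.
    Cut : Fin (suc d) → V → Set
    Cut F.zero = Merged
    Cut (F.suc _) = Ball

    cut? : ∀ i x → Dec (Cut i x)
    cut? F.zero = merged?
    cut? (F.suc _) = ball?

    ball⊆cut : ∀ i {x} → Ball x → Cut i x
    ball⊆cut F.zero = inj₁
    ball⊆cut (F.suc _) x∈B = x∈B

    cut⊆merged : ∀ i {x} → Cut i x → Merged x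
    cut⊆merged F.zero x∈ = x∈
    cut⊆merged (F.suc _) = inj₁

    uncut⇒≢z : ∀ i {x} → ¬ Cut i x → x ≢ z
    uncut⇒≢z i x∉ refl = x∉ (ball⊆cut i here)

    trim : Fin (suc d) → Subset (order G) → Subset (order G)
    trim i U = subset (λ x → (x ∈? U) ×-dec ¬? (cut? i x))

    ∈trim : ∀ i U {x} → x ∈ trim i U → x ∈ U × ¬ Cut i x
    ∈trim i U = ∈subset⁻ (λ x → (x ∈? U) ×-dec ¬? (cut? i x))

    trimmed : Family d
    trimmed i = map (trim i) (𝓤 i)

    𝓥 : Family d
    𝓥 F.zero = C ∷ trimmed F.zero
    𝓥 (F.suc i) = trimmed (F.suc i)

    trimmed⊆𝓥 : ∀ i {W} → W ∈ₗ trimmed i → W ∈ₗ 𝓥 i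
    trimmed⊆𝓥 F.zero = there
    trimmed⊆𝓥 (F.suc _) W∈ = W∈

    avoids-z : ∀ {x y} → ¬ Ball y → Walk D r x y → Walk (z ∷ D) r x y
    avoids-z y∉ w with avoid-or-from z w
    ... | inj₁ w' = w'
    ... | inj₂ zy = ⊥-elim (y∉ zy)

    -- Trimmed sets inherit separation and boundedness from 𝓤: their vertices
    -- avoid z, and short walks between them avoid z.
    trimmed-separated : ∀ i W W' → W ∈ₗ trimmed i → W' ∈ₗ trimmed i → W ≢ W' →
      ∀ x x' → x ∈ W → x' ∈ W' → x ∉ₗ D → x' ∉ₗ D → ¬ Walk D r x x'
    trimmed-separated i W W' W∈ W'∈ W≢W' x x' x∈ x'∈ x∉ x'∉ w
      with ∈-map⁻ (trim i) W∈ | ∈-map⁻ (trim i) W'∈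
    ... | U , U∈ , refl | U' , U'∈ , refl =
      let x∈U , x-uncut = ∈trim i U x∈
          x'∈U' , x'-uncut = ∈trim i U' x'∈
      in sep i U U' U∈ U'∈ (λ U≡U' → W≢W' (cong (trim i) U≡U')) x x' x∈U x'∈U'
           (∉-∷ x∉ (uncut⇒≢z i x-uncut)) (∉-∷ x'∉ (uncut⇒≢z i x'-uncut))
           (avoids-z (λ x'∈B → x'-uncut (ball⊆cut i x'∈B)) w)

    trimmed-bounded : ∀ i W → W ∈ₗ trimmed i → ∀ x x' → x ∈ W → x' ∈ W →
      x ∉ₗ D → x' ∉ₗ D → Walk D (grow f r) x x'
    trimmed-bounded i W W∈ x x' x∈ x'∈ x∉ x'∉ with ∈-map⁻ (trim i) W∈
    ... | U , U∈ , refl =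
      let x∈U , x-uncut = ∈trim i U x∈
          x'∈U , x'-uncut = ∈trim i U x'∈
      in walk-mono (f≤grow f r) (unavoid (bnd i U U∈ x x' x∈U x'∈U
           (∉-∷ x∉ (uncut⇒≢z i x-uncut)) (∉-∷ x'∉ (uncut⇒≢z i x'-uncut))))

    -- Every merged vertex is within r + r + f r of z: through a member near
    -- z, within 2r of z and of diameter ≤ f r.
    merged-near-z : ∀ {x} → Merged x → x ∉ₗ D → Walk D (r + r + f r) z x
    merged-near-z (inj₁ zx) _ = walk-mono (≤-trans (m≤m+n r r) (m≤m+n (r + r) (f r))) zx
    merged-near-z {x} (inj₂ near) x∉ with x FP.≟ z | find near
    ... | yes refl | _ = here
    ... | no x≢z | U , U∈ , (u , u∈U , u∉ , zu) , x∈U =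
      zu ++ʷ unavoid (bnd F.zero U U∈ u x u∈U x∈U u∉ (∉-∷ x∉ x≢z))

    C-bounded : ∀ x x' → x ∈ C → x' ∈ C → x ∉ₗ D → x' ∉ₗ D → Walk D (grow f r) x x'
    C-bounded x x' x∈ x'∈ x∉ x'∉ =
      reverse (merged-near-z (∈subset⁻ merged? x∈) x∉) x∉ ++ʷ merged-near-z (∈subset⁻ merged? x'∈) x'∉

    -- A vertex of a member U of 𝓤 0 within r of the ball makes U near z,
    -- so it is merged.
    ball-separated : ∀ {U x x'} → U ∈ₗ 𝓤 F.zero → Ball x → x' ∈ U → x' ∉ₗ D → ¬ Merged x' →
      ¬ Walk D r x x'
    ball-separated {x' = x'} U∈ zx x'∈U x'∉ x'-unmerged w =
      x'-unmerged (inj₂ (lose U∈ ((x' , x'∈U , ∉-∷ x'∉ (uncut⇒≢z F.zero x'-unmerged) , zx ++ʷ w) , x'∈U)))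

    -- The merged set is r-separated from the unmerged rest of each member of
    -- 𝓤 0: otherwise that member would be near z, or would be at distance
    -- ≤ r from a different member near z.
    merged-separated : ∀ {U x x'} → U ∈ₗ 𝓤 F.zero → Merged x → x' ∈ U → ¬ Merged x' →
      x ∉ₗ D → x' ∉ₗ D → ¬ Walk D r x x'
    merged-separated U∈ (inj₁ zx) x'∈U x'-unmerged _ x'∉ =
      ball-separated U∈ zx x'∈U x'∉ x'-unmerged
    merged-separated {U} {x} {x'} U∈ (inj₂ near) x'∈U x'-unmerged x∉ x'∉ w with x FP.≟ z | find near
    ... | yes refl | _ = ball-separated U∈ here x'∈U x'∉ x'-unmerged w
    ... | no x≢z | U″ , U″∈ , U″-near , x∈U″ =
      sep F.zero U″ U U″∈ U∈ (λ U″≡U → x'-unmerged (inj₂ (lose U∈ (subst Near U″≡U U″-near , x'∈U))))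
        x x' x∈U″ x'∈U (∉-∷ x∉ x≢z) (∉-∷ x'∉ (uncut⇒≢z F.zero x'-unmerged))
        (avoids-z (λ x'∈B → x'-unmerged (inj₁ x'∈B)) w)

    C-separated : ∀ {W x x'} → W ∈ₗ trimmed F.zero → x ∈ C → x' ∈ W →
      x ∉ₗ D → x' ∉ₗ D → ¬ Walk D r x x'
    C-separated W∈ x∈ x'∈ with ∈-map⁻ (trim F.zero) W∈
    ... | U , U∈ , refl =
      let x'∈U , x'-unmerged = ∈trim F.zero U x'∈
      in merged-separated U∈ (∈subset⁻ merged? x∈) x'∈U x'-unmerged

    covers : CoversOutside D d 𝓥
    covers x x∉ with merged? x
    ... | yes x-merged = F.zero , C , here refl , ∈subset⁺ merged? x-merged
    ... | no x-unmerged with cov x (∉-∷ x∉ (uncut⇒≢z F.zero x-unmerged))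
    ...   | i , U , U∈ , x∈U =
      i , trim i U , trimmed⊆𝓥 i (∈-map⁺ (trim i) U∈) ,
      ∈subset⁺ (λ y → (y ∈? U) ×-dec ¬? (cut? i y)) (x∈U , λ x-cut → x-unmerged (cut⊆merged i x-cut))

    separated : SeparatedOutside D d 𝓥 r
    separated F.zero _ _ (here refl) (here refl) C≢C = ⊥-elim (C≢C refl)
    separated F.zero _ _ (here refl) (there W'∈) _ x x' x∈ x'∈ x∉ x'∉ =
      C-separated W'∈ x∈ x'∈ x∉ x'∉
    separated F.zero _ _ (there W∈) (here refl) _ x x' x∈ x'∈ x∉ x'∉ w =
      C-separated W∈ x'∈ x∈ x'∉ x∉ (reverse w x'∉)
    separated F.zero W W' (there W∈) (there W'∈) = trimmed-separated F.zero W W' W∈ W'∈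
    separated (F.suc i) = trimmed-separated (F.suc i)

    bounded : BoundedOutside D d 𝓥 (grow f r)
    bounded F.zero _ (here refl) = C-bounded
    bounded F.zero W (there W∈) = trimmed-bounded F.zero W W∈
    bounded (F.suc i) = trimmed-bounded (F.suc i)

  restore : ∀ z D {d f} → ControlledOutside (z ∷ D) d f → ControlledOutside D d (grow f)
  restore z D {f = f} ctrl r with ctrl r
  ... | 𝓤 , cov , sep , bnd = 𝓥 , covers , separated , bounded
    where open Restore z D {f = f} 𝓤 cov sep bnd

  restore-all : ∀ zs {d f} → ControlledOutside zs d f → ControlledOutside [] d (growⁿ (length zs) f)
  restore-all [] ctrl = ctrl
  restore-all (z ∷ zs) ctrl = restore-all zs (restore z zs ctrl)

-- A deletion G − Z ≅ H identifies H with G outside the elements of Z, so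
-- control of H is control of G outside Z.
module FromDeletion {G H : Graph} {Z : Subset (order G)} (del : Deletion G Z H) where
  open Avoiding G
  open Deletion del

  removed : List V
  removed = elements Z

  emb-injective : ∀ {i j} → emb i ≡ emb j → i ≡ j
  emb-injective {i} {j} eq with FP.<-cmp i j
  ... | tri< i<j _ _ = ⊥-elim (FP.<-irrefl eq (increasing i j i<j))
  ... | tri≈ _ i≡j _ = i≡j
  ... | tri> _ _ j<i = ⊥-elim (FP.<-irrefl (≡-sym eq) (increasing j i j<i))

  emb∉removed : ∀ i → emb i ∉ₗ removed
  emb∉removed i ∈removed = avoids i (∈elements⁻ ∈removed)

  push : ∀ {m i j} → Reach H m i j → Walk removed m (emb i) (emb j)
  push here = here
  push {i = i} (step {y = k} e p) = step (emb∉removed i) (trans (≡-sym (induced i k)) e) (push p)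

  pull : ∀ {m x y} → Walk removed m x y → ∀ i j → emb i ≡ x → emb j ≡ y → Reach H m i j
  pull here i j refl ej = subst (Reach H _ i) (≡-sym (emb-injective ej)) here
  pull (step {y = y} _ e w) i j refl ej
    with onto y (λ y∈Z → start∉ w (subst (_∉ₗ removed) ej (emb∉removed j)) (∈elements⁺ y∈Z))
  ... | k , refl = step (trans (induced i k) e) (pull w k j refl ej)

  image : Subset (order H) → Subset (order G)
  image U = subset (λ v → FP.any? (λ i → (emb i FP.≟ v) ×-dec (i ∈? U)))

  ∈image⁻ : ∀ {U v} → v ∈ image U → ∃[ i ] (emb i ≡ v × i ∈ U)
  ∈image⁻ {U} = ∈subset⁻ (λ v → FP.any? (λ i → (emb i FP.≟ v) ×-dec (i ∈? U)))

  controlled-outside-Z : ∀ {d f} → Controls H d f → ControlledOutside removed d f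
  controlled-outside-Z {d} {f} ctrl r with ctrl r
  ... | 𝓤 , cov , sep , bnd = 𝓥 , covers , separated , bounded
    where
    𝓥 : Family d
    𝓥 i = map image (𝓤 i)

    covers : CoversOutside removed d 𝓥
    covers v v∉ with onto v (λ v∈Z → v∉ (∈elements⁺ v∈Z))
    ... | i , refl with cov i
    ...   | j , U , U∈ , i∈U =
      j , image U , ∈-map⁺ image U∈ ,
      ∈subset⁺ (λ v → FP.any? (λ i → (emb i FP.≟ v) ×-dec (i ∈? U))) (i , refl , i∈U)

    separated : SeparatedOutside removed d 𝓥 r
    separated j W W' W∈ W'∈ W≢W' x x' x∈ x'∈ _ _ w with ∈-map⁻ image W∈ | ∈-map⁻ image W'∈
    ... | U , U∈ , refl | U' , U'∈ , refl with ∈image⁻ x∈ | ∈image⁻ x'∈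
    ...   | i , ei , i∈U | i' , ei' , i'∈U' =
      sep j U U' U∈ U'∈ (λ U≡U' → W≢W' (cong image U≡U')) i i' i∈U i'∈U' (pull w i i' ei ei')

    bounded : BoundedOutside removed d 𝓥 (f r)
    bounded j W W∈ x x' x∈ x'∈ _ _ with ∈-map⁻ image W∈
    ... | U , U∈ , refl with ∈image⁻ x∈ | ∈image⁻ x'∈
    ...   | i , refl , i∈U | i' , refl , i'∈U = push (bnd j U U∈ i i' i∈U i'∈U)

⊆Plus : ∀ (𝓕 : Class) n G → 𝓕 G → Plus 𝓕 n G
⊆Plus 𝓕 n G G∈𝓕 = ⊥ , subst (_≤ n) (≡-sym (∣⊥∣≡0 (order G))) z≤n , G , delete-nothing , G∈𝓕
  where
  delete-nothing : Deletion G ⊥ G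
  delete-nothing = record
    { emb = λ i → i ; increasing = λ _ _ i<j → i<j ; onto = λ v _ → v , refl
    ; avoids = λ _ → ∉⊥ ; induced = λ _ _ → refl }

dimPlus⇒dim : ∀ 𝓕 n d → HasDim (Plus 𝓕 n) d → HasDim 𝓕 d
dimPlus⇒dim 𝓕 n d (f , ctrl) = f , λ G G∈𝓕 → ctrl G (⊆Plus 𝓕 n G G∈𝓕)

dim⇒dimPlus : ∀ 𝓕 n d → HasDim 𝓕 d → HasDim (Plus 𝓕 n) d
dim⇒dimPlus 𝓕 n d (f , ctrl) = growⁿ n f , λ { G (Z , |Z|≤n , H , del , H∈𝓕) →
  let open Avoiding G
      open FromDeletion del
      |removed|≤n = ≤-trans (≤-reflexive (length-elements Z)) |Z|≤n
  in controlled-[] (controlled-mono (growⁿ-monoⁿ (≤⇒≤′ |removed|≤n) f)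
                     (restore-all removed (controlled-outside-Z (ctrl H H∈𝓕)))) }

ad-transfer : ∀ {𝓐 𝓑 : Class} {d} → (∀ e → HasDim 𝓐 e → HasDim 𝓑 e) →
  (∀ e → HasDim 𝓑 e → HasDim 𝓐 e) → AdIs 𝓐 d → AdIs 𝓑 d
ad-transfer {d = d} a⇒b b⇒a (has , none-below) =
  a⇒b d has , λ e e<d has' → none-below e e<d (b⇒a e has')

same-ad : ∀ {𝓐 𝓑 : Class} → (∀ e → HasDim 𝓐 e → HasDim 𝓑 e) → (∀ e → HasDim 𝓑 e → HasDim 𝓐 e) →
  ((d : ℕ) → AdIs 𝓐 d ⇔ AdIs 𝓑 d) × (AdInfinite 𝓐 ⇔ AdInfinite 𝓑)
same-ad a⇒b b⇒a =
  (λ d → mk⇔ (ad-transfer a⇒b b⇒a) (ad-transfer b⇒a a⇒b)) ,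
  mk⇔ (λ none e has → none e (b⇒a e has)) (λ none e has → none e (a⇒b e has))

theorem4p3 : (𝓕 : Class) (n : ℕ) →
    ((d : ℕ) → AdIs (Plus 𝓕 n) d ⇔ AdIs 𝓕 d) × (AdInfinite (Plus 𝓕 n) ⇔ AdInfinite 𝓕)
theorem4p3 𝓕 n = same-ad (dimPlus⇒dim 𝓕 n) (dim⇒dimPlus 𝓕 n)
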